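{- If $G$ is a (short normal-play) partizan game and $i\in\{0,1\}$, then $\phi_i(G)$ is a well-tempered scoring game with $\pi(\phi_i(G))=i$. Moreover, $\phi_i(G)\in\mathcal{J}$ and $\psi(\phi_i(G))=G$ (equality of partizan game values).
   Context: A well-tempered scoring game is defined recursively: an even-tempered game is either an integer or a pair $\{G^L|G^R\}$ with finite nonempty sets of odd-tempered left and right options; an odd-tempered game is a pair $\{G^L|G^R\}$ with finite nonempty sets of even-tempered options. Integers have no options. $\pi(G)=0$ for even-tempered, $1$ for odd-tempered games. Subgames: $G$ and subgames of its options. Outcomes: $\operatorname{L}(n)=\operatorname{R}(n)=n$ for integers, otherwise $\operatorname{L}(G)=\max_{G^L}\operatorname{R}(G^L)$, $\operatorname{R}(G)=\min_{G^R}\operatorname{L}(G^R)$. $\operatorname{gap}_i(G)$ ($i=0,1$) is the supremum of $\operatorname{R}(K)-\operatorname{L}(K)$ over subgames $K$ with $\pi(K)=i$ (empty supremum $-\infty$); $\mathcal{J}$ is the class of games with $\operatorname{gap}_0=0$ and $\operatorname{gap}_1\le 2$. The map $\psi$ from scoring games to partizan games: $\psi(n)=n$, $\psi(\{G^L|G^R\})=\{\psi(G^L)|\psi(G^R)\}$. For a partizan game form $G$: $\phi_0(G)=n$ if $G$ equals an integer $n$, else $\phi_0(G)=\{\phi_1(G^L)|\phi_1(G^R)\}$; $\phi_1(G)=\{n-1|n+1\}$ if $G$ equals an integer $n$, else $\phi_1(G)=\{\phi_0(G^L)|\phi_0(G^R)\}$. -}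

module Defs where

open import Data.Bool using (Bool; true; false; not; _∧_; _∨_)
open import Data.Nat using (ℕ; zero; suc)
open import Data.Integer using (ℤ; +_; -[1+_]; _-_; _+_; _⊔_; _⊓_; _≤_; 0ℤ; 1ℤ)
open import Data.Fin using (Fin; zero; suc)
open import Data.List using (List; []; _∷_)
open import Data.List.Membership.Propositional using (_∈_)
open import Data.List.Relation.Binary.Pointwise using (Pointwise)
open import Data.Product using (_×_; Σ; ∃)
open import Relation.Binary.PropositionalEquality using (_≡_)
open import Relation.Nullary using (¬_)

data PGame : Set where
  pnode : List PGame → List PGame → PGame

⌜_⌝ : ℤ → PGame
⌜ + zero ⌝ = pnode [] []
⌜ + suc k ⌝ = pnode (⌜ + k ⌝ ∷ []) []
⌜ -[1+ zero ] ⌝ = pnode [] (⌜ + zero ⌝ ∷ [])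
⌜ -[1+ suc k ] ⌝ = pnode [] (⌜ -[1+ k ] ⌝ ∷ [])

mutual
  leq : PGame → PGame → Bool
  leq (pnode GL GR) (pnode HL HR) =
    not (existsL (pnode HL HR) GL) ∧ not (existsR (pnode GL GR) HR)

  existsL : PGame → List PGame → Bool
  existsL H [] = false
  existsL H (g ∷ gs) = leq H g ∨ existsL H gs

  existsR : PGame → List PGame → Bool
  existsR G [] = false
  existsR G (h ∷ hs) = leq h G ∨ existsR G hs

_≤G_ : PGame → PGame → Set
G ≤G H = leq G H ≡ true

_≈G_ : PGame → PGame → Set
G ≈G H = (G ≤G H) × (H ≤G G)

data SGame : Set where
  int  : ℤ → SGame
  snode : List SGame → List SGame → SGame

-- parity 0 = even, 1 = odd
flip : Fin 2 → Fin 2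
flip zero = suc zero
flip (suc _) = zero

data NonEmpty {A : Set} : List A → Set where
  nonempty : ∀ {x xs} → NonEmpty (x ∷ xs)

-- WT i G : G is a well-tempered scoring game with π(G) = i
data WT : Fin 2 → SGame → Set where
  wt-int  : ∀ {n} → WT zero (int n)
  wt-node : ∀ {i L R} → NonEmpty L → NonEmpty R →
            (∀ {K} → K ∈ L → WT (flip i) K) →
            (∀ {K} → K ∈ R → WT (flip i) K) →
            WT i (snode L R)

-- Outcomes. For well-tempered games option lists are nonempty; the value 0
-- for an empty option list is a dummy that is never used on such games.
mutual
  Lo : SGame → ℤ
  Lo (int n) = n
  Lo (snode [] R) = 0ℤ
  Lo (snode (g ∷ gs) R) = maxRo g gs

  Ro : SGame → ℤ
  Ro (int n) = n
  Ro (snode L []) = 0ℤ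
  Ro (snode L (g ∷ gs)) = minLo g gs

  maxRo : SGame → List SGame → ℤ
  maxRo g [] = Ro g
  maxRo g (h ∷ hs) = Ro g ⊔ maxRo h hs

  minLo : SGame → List SGame → ℤ
  minLo g [] = Lo g
  minLo g (h ∷ hs) = Lo g ⊓ minLo h hs

data _⊑_ : SGame → SGame → Set where
  sub-refl  : ∀ {G} → G ⊑ G
  sub-left  : ∀ {K GL L R} → GL ∈ L → K ⊑ GL → K ⊑ snode L R
  sub-right : ∀ {K GR L R} → GR ∈ R → K ⊑ GR → K ⊑ snode L R

-- gap_i(G) ≤ v  (supremum over subgames K with π(K) = i; empty sup is -∞)
GapAtMost : Fin 2 → SGame → ℤ → Set
GapAtMost i G v = ∀ K → K ⊑ G → WT i K → (Ro K - Lo K) ≤ v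

-- gap_i(G) = v  (the finite supremum is v: an upper bound that is attained)
GapEq : Fin 2 → SGame → ℤ → Set
GapEq i G v = GapAtMost i G v × Σ SGame (λ K → K ⊑ G × WT i K × (Ro K - Lo K) ≡ v)

InJ : SGame → Set
InJ G = GapEq zero G 0ℤ × GapAtMost (suc zero) G (+ 2)

mutual
  ψ : SGame → PGame
  ψ (int n) = ⌜ n ⌝
  ψ (snode L R) = pnode (ψs L) (ψs R)

  ψs : List SGame → List PGame
  ψs [] = []
  ψs (g ∷ gs) = ψ g ∷ ψs gs

-- φ_i, given by its graph: Phi i G S means φ_i(G) = S.
-- "G equals an integer n" is G ≈G ⌜ n ⌝.

data Phi : Fin 2 → PGame → SGame → Set where
  phi0-int : ∀ {G n} → G ≈G ⌜ n ⌝ → Phi zero G (int n)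
  phi1-int : ∀ {G n} → G ≈G ⌜ n ⌝ →
             Phi (suc zero) G (snode (int (n - 1ℤ) ∷ []) (int (n + 1ℤ) ∷ []))
  phi-node : ∀ {i GL GR SL SR} →
             (∀ n → ¬ (pnode GL GR ≈G ⌜ n ⌝)) →
             Pointwise (Phi (flip i)) GL SL →
             Pointwise (Phi (flip i)) GR SR →
             Phi i (pnode GL GR) (snode SL SR)

module Submission where

-- An integer m lies above a non-integer G as soon as it lies above every left option of G:
-- otherwise m + 1 ≤ G, so m lies strictly between the options of G, and the simplicity theorem
-- would make G an integer. Unfolding φᵢ with this fact, induction gives
--   G ≤ m  ⇔  L(φᵢ G) ≤ m   and   m ≤ G  ⇔  m ≤ R(φᵢ G)      for i = 0,
--   G ≤ m  ⇔  L(φᵢ G) < m   and   m ≤ G  ⇔  m < R(φᵢ G)      for i = 1,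
-- because the options of φᵢ G have the other parity and ¬ (m ≤ x) ⇔ x < m. Taking m at the outcomes
-- themselves yields R − L ≤ 0 for φ₀ G and R − L ≤ 2 for φ₁ G, and every subgame of φᵢ G is again
-- of the form φⱼ H. Well-temperedness and ψ ∘ φᵢ = id are direct inductions; existence of φᵢ G needs
-- that equality with an integer is decidable, which holds since such an integer is bounded by the
-- height of G.

open import Defs
open import Data.Bool using (true; false; not; _∧_)
open import Data.Bool.Properties using (T-≡; _≟_; ∨-identityʳ; ∧-identityʳ; ∧-zeroʳ)
open import Data.Nat as ℕ using (ℕ; zero; suc)
import Data.Nat.Properties as ℕ
open import Data.Integer as ℤ using (ℤ; +_; -[1+_]; _≤_; _≥_; _<_; _⊔_; _⊓_; 0ℤ; 1ℤ)
import Data.Integer.Properties as ℤ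
open import Data.Integer.Tactic.RingSolver using (solve-∀)
open import Data.List using (List; []; _∷_)
open import Data.List.Relation.Unary.All as All using (All; []; _∷_)
open import Data.List.Relation.Unary.Any using (here; there)
open import Data.List.Membership.Propositional using (_∈_)
open import Data.List.Relation.Binary.Pointwise as Pointwise using (Pointwise; []; _∷_)
open import Data.Fin using (Fin; zero; suc)
open import Data.Product using (_×_; _,_; proj₁; proj₂; Σ; curry; uncurry)
open import Data.Sum using (_⊎_; inj₁; inj₂)
open import Data.Empty using (⊥-elim)
open import Data.Product.Function.NonDependent.Propositional using (_×-⇔_)
open import Function using (_∘_)
open import Function.Bundles using (_⇔_; mk⇔; Equivalence)
open import Function.Construct.Composition using (_⇔-∘_)
open import Function.Related.TypeIsomorphisms using (¬-cong-⇔)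
open import Function.Properties.Equivalence using (⇔-setoid)
import Relation.Binary.Reasoning.Setoid as SetoidReasoning
open import Level using (0ℓ)
open import Relation.Binary.Definitions using (_Respects_)
open import Relation.Binary.PropositionalEquality
open import Relation.Nullary using (¬_; contradiction; Dec; yes; no; _×-dec_; _⊎-dec_)

open Equivalence using (to; from)
module ⇔-Reasoning = SetoidReasoning (⇔-setoid 0ℓ)

leftOptions rightOptions : PGame → List PGame
leftOptions  (pnode L R) = L
rightOptions (pnode L R) = R

PGame-ind : (P : PGame → Set) →
            (∀ {L R} → All P L → All P R → P (pnode L R)) →
            ∀ G → P G
PGame-ind P step (pnode L R) = step (all L) (all R)
  where
  all : ∀ Gs → All P Gs
  all []       = []
  all (G ∷ Gs) = PGame-ind P step G ∷ all Gs

existsL≡false⇔ : ∀ H gs → existsL H gs ≡ false ⇔ All (λ g → ¬ H ≤G g) gs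
existsL≡false⇔ H [] = mk⇔ (λ _ → []) (λ _ → refl)
existsL≡false⇔ H (g ∷ gs) with leq H g in H≤g
... | true  = mk⇔ (λ ()) (λ { (H≰g ∷ _) → contradiction H≤g H≰g })
... | false = mk⇔ (λ rest → (λ H≤g′ → contradiction (trans (sym H≤g) H≤g′) λ ()) ∷ to (existsL≡false⇔ H gs) rest)
                  (λ { (_ ∷ rest) → from (existsL≡false⇔ H gs) rest })

existsR≡false⇔ : ∀ G hs → existsR G hs ≡ false ⇔ All (λ h → ¬ h ≤G G) hs
existsR≡false⇔ G [] = mk⇔ (λ _ → []) (λ _ → refl)
existsR≡false⇔ G (h ∷ hs) with leq h G in h≤G
... | true  = mk⇔ (λ ()) (λ { (h≰G ∷ _) → contradiction h≤G h≰G })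
... | false = mk⇔ (λ rest → (λ h≤G′ → contradiction (trans (sym h≤G) h≤G′) λ ()) ∷ to (existsR≡false⇔ G hs) rest)
                  (λ { (_ ∷ rest) → from (existsR≡false⇔ G hs) rest })

not∧not≡true⇔ : ∀ {x y} → not x ∧ not y ≡ true ⇔ (x ≡ false × y ≡ false)
not∧not≡true⇔ {false} {false} = mk⇔ (λ _ → refl , refl) (λ _ → refl)
not∧not≡true⇔ {false} {true}  = mk⇔ (λ ()) (λ { (_ , ()) })
not∧not≡true⇔ {true}  {_}     = mk⇔ (λ ()) (λ { (() , _) })

≤G⇔ : ∀ {G H} → G ≤G H ⇔ (All (λ g → ¬ H ≤G g) (leftOptions G) × All (λ h → ¬ h ≤G G) (rightOptions H))
≤G⇔ {G@(pnode GL _)} {H@(pnode _ HR)} =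
  (existsL≡false⇔ H GL ×-⇔ existsR≡false⇔ G HR) ⇔-∘ not∧not≡true⇔

≤G-intro : ∀ {G H} → All (λ g → ¬ H ≤G g) (leftOptions G) → All (λ h → ¬ h ≤G G) (rightOptions H) → G ≤G H
≤G-intro {G} {H} GL⧏H G⧏HR = from (≤G⇔ {G} {H}) (GL⧏H , G⧏HR)

≤G-left : ∀ {G H} → G ≤G H → All (λ g → ¬ H ≤G g) (leftOptions G)
≤G-left {G} {H} G≤H = proj₁ (to (≤G⇔ {G} {H}) G≤H)

≤G-right : ∀ {G H} → G ≤G H → All (λ h → ¬ h ≤G G) (rightOptions H)
≤G-right {G} {H} G≤H = proj₂ (to (≤G⇔ {G} {H}) G≤H)

≤G-refl : ∀ G → G ≤G G
≤G-refl = PGame-ind (λ G → G ≤G G) λ {L} {R} L-refl R-refl →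
  let G = pnode L R in
  ≤G-intro {G} {G}
    (All.tabulate λ {g} g∈L G≤g → All.lookup (≤G-left {G} {g} G≤g) g∈L (All.lookup L-refl g∈L))
    (All.tabulate λ {h} h∈R h≤G → All.lookup (≤G-right {h} {G} h≤G) h∈R (All.lookup R-refl h∈R))

-- Terminates by size change: the three games rotate, and one of them is replaced by an option.
mutual
  ≤G-trans : ∀ A B C → A ≤G B → B ≤G C → A ≤G C
  ≤G-trans A@(pnode AL _) B@(pnode _ _) C@(pnode _ CR) A≤B B≤C =
    ≤G-intro {A} {C} (⧏-trans AL B C (≤G-left {A} {B} A≤B) B≤C) (⧐-trans CR A B (≤G-right {B} {C} B≤C) A≤B)

  ⧏-trans : ∀ as B C → All (λ a → ¬ B ≤G a) as → B ≤G C → All (λ a → ¬ C ≤G a) as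
  ⧏-trans []       B C []           B≤C = []
  ⧏-trans (a ∷ as) B C (B≰a ∷ B≰as) B≤C = (B≰a ∘ ≤G-trans B C a B≤C) ∷ ⧏-trans as B C B≰as B≤C

  ⧐-trans : ∀ cs A B → All (λ c → ¬ c ≤G B) cs → A ≤G B → All (λ c → ¬ c ≤G A) cs
  ⧐-trans []       A B []           A≤B = []
  ⧐-trans (c ∷ cs) A B (c≰B ∷ c≰Bs) A≤B = (c≰B ∘ λ c≤A → ≤G-trans c A B c≤A A≤B) ∷ ⧐-trans cs A B c≰Bs A≤B

_≤?G_ : ∀ G H → Dec (G ≤G H)
G ≤?G H = leq G H ≟ true

≈G-refl : ∀ G → G ≈G G
≈G-refl G = ≤G-refl G , ≤G-refl G

≈G-sym : ∀ {G H} → G ≈G H → H ≈G G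
≈G-sym (G≤H , H≤G) = H≤G , G≤H

≈G-trans : ∀ {A B C} → A ≈G B → B ≈G C → A ≈G C
≈G-trans {A} {B} {C} (A≤B , B≤A) (B≤C , C≤B) = ≤G-trans A B C A≤B B≤C , ≤G-trans C B A C≤B B≤A

_≈?G_ : ∀ G H → Dec (G ≈G H)
G ≈?G H = (G ≤?G H) ×-dec (H ≤?G G)

≈G⇒≤G⇔ˡ : ∀ {G H K} → G ≈G H → G ≤G K ⇔ H ≤G K
≈G⇒≤G⇔ˡ {G} {H} {K} (G≤H , H≤G) = mk⇔ (≤G-trans H G K H≤G) (≤G-trans G H K G≤H)

≈G⇒≤G⇔ʳ : ∀ {G H K} → G ≈G H → K ≤G G ⇔ K ≤G H
≈G⇒≤G⇔ʳ {G} {H} {K} (G≤H , H≤G) = mk⇔ (λ K≤G → ≤G-trans K G H K≤G G≤H) (λ K≤H → ≤G-trans K H G K≤H H≤G)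

leftOption⧏ : ∀ {G g} → g ∈ leftOptions G → ¬ G ≤G g
leftOption⧏ {G} {g} g∈ G≤g = All.lookup (≤G-left {G} {g} G≤g) g∈ (≤G-refl g)

rightOption⧐ : ∀ {G h} → h ∈ rightOptions G → ¬ h ≤G G
rightOption⧐ {G} {h} h∈ h≤G = All.lookup (≤G-right {h} {G} h≤G) h∈ (≤G-refl h)

⌜-[1+]⌝≡ : ∀ k → ⌜ -[1+ k ] ⌝ ≡ pnode [] (⌜ ℤ.- + k ⌝ ∷ [])
⌜-[1+]⌝≡ zero    = refl
⌜-[1+]⌝≡ (suc k) = refl

leftOptions-⌜-[1+]⌝ : ∀ {P : PGame → Set} k → All P (leftOptions ⌜ -[1+ k ] ⌝)
leftOptions-⌜-[1+]⌝ zero    = []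
leftOptions-⌜-[1+]⌝ (suc k) = []

rightOptions-⌜-[1+]⌝ : ∀ {P : PGame → Set} k → P ⌜ ℤ.- + k ⌝ → All P (rightOptions ⌜ -[1+ k ] ⌝)
rightOptions-⌜-[1+]⌝ zero    p = p ∷ []
rightOptions-⌜-[1+]⌝ (suc k) p = p ∷ []

not-<ᵇ : ∀ m n → not (m ℕ.<ᵇ n) ≡ (n ℕ.<ᵇ suc m)
not-<ᵇ m       zero    = refl
not-<ᵇ zero    (suc n) = refl
not-<ᵇ (suc m) (suc n) = not-<ᵇ m n

leq-⌜⌝ : ∀ a b → leq ⌜ a ⌝ ⌜ b ⌝ ≡ (a ℤ.≤ᵇ b)
leq-⌜⌝ (+ zero)  (+ zero)  = refl
leq-⌜⌝ (+ zero)  (+ suc k) = refl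
leq-⌜⌝ (+ suc j) (+ zero)  rewrite leq-⌜⌝ (+ zero) (+ j) = refl
leq-⌜⌝ (+ suc j) (+ suc k) rewrite leq-⌜⌝ (+ suc k) (+ j) | ∨-identityʳ (k ℕ.<ᵇ j) | ∧-identityʳ (not (k ℕ.<ᵇ j))
  = not-<ᵇ k j
leq-⌜⌝ (+ zero)  -[1+ zero ]  = refl
leq-⌜⌝ (+ zero)  -[1+ suc k ] rewrite leq-⌜⌝ -[1+ k ] (+ zero) = refl
leq-⌜⌝ (+ suc j) -[1+ zero ]  = ∧-zeroʳ _
leq-⌜⌝ (+ suc j) -[1+ suc k ] rewrite leq-⌜⌝ -[1+ k ] (+ suc j) = ∧-zeroʳ _
leq-⌜⌝ -[1+ a ] (+ zero)  rewrite ⌜-[1+]⌝≡ a = refl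
leq-⌜⌝ -[1+ a ] (+ suc b) rewrite ⌜-[1+]⌝≡ a = refl
leq-⌜⌝ -[1+ zero ]  -[1+ zero ]  = refl
leq-⌜⌝ -[1+ suc a ] -[1+ zero ]  rewrite leq-⌜⌝ -[1+ a ] (+ zero) = refl
leq-⌜⌝ -[1+ zero ]  -[1+ suc b ] rewrite leq-⌜⌝ -[1+ b ] -[1+ zero ] = refl
leq-⌜⌝ -[1+ suc a ] -[1+ suc b ] rewrite leq-⌜⌝ -[1+ b ] -[1+ suc a ] | ∨-identityʳ (a ℕ.<ᵇ b)
  = not-<ᵇ a b

⌜⌝-≤⇔ : ∀ {a b} → ⌜ a ⌝ ≤G ⌜ b ⌝ ⇔ a ≤ b
⌜⌝-≤⇔ {a} {b} rewrite leq-⌜⌝ a b = mk⇔ (ℤ.≤ᵇ⇒≤ ∘ from T-≡) (to T-≡ ∘ ℤ.≤⇒≤ᵇ)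

<+1⇔≤ : ∀ {m n} → m < n ℤ.+ 1ℤ ⇔ m ≤ n
<+1⇔≤ {m} {n} rewrite ℤ.+-comm n 1ℤ =
  mk⇔ (λ m<n+1 → subst (m ≤_) (ℤ.pred-suc n) (ℤ.i<j⇒i≤pred[j] m<n+1))
      (ℤ.suc[i]≤j⇒i<j ∘ ℤ.suc-mono)

-1<⇔≤ : ∀ {m n} → m ℤ.- 1ℤ < n ⇔ m ≤ n
-1<⇔≤ {m} {n} rewrite ℤ.+-comm m ℤ.-1ℤ =
  mk⇔ (λ m-1<n → subst (_≤ n) (ℤ.suc-pred m) (ℤ.i<j⇒suc[i]≤j m-1<n))
      (λ m≤n → ℤ.suc[i]≤j⇒i<j (subst (_≤ n) (sym (ℤ.suc-pred m)) m≤n))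

leftOption-⌜⌝ : ∀ m {l} → l ∈ leftOptions ⌜ m ⌝ → l ≡ ⌜ m ℤ.- 1ℤ ⌝
leftOption-⌜⌝ (+ suc k)    (here refl) = refl
leftOption-⌜⌝ (+ zero)     ()
leftOption-⌜⌝ -[1+ zero ]  ()
leftOption-⌜⌝ -[1+ suc k ] ()

rightOption-⌜⌝ : ∀ m {r} → r ∈ rightOptions ⌜ m ⌝ → r ≡ ⌜ m ℤ.+ 1ℤ ⌝
rightOption-⌜⌝ -[1+ zero ]  (here refl) = refl
rightOption-⌜⌝ -[1+ suc k ] (here refl) = refl
rightOption-⌜⌝ (+ zero)     ()
rightOption-⌜⌝ (+ suc k)    ()

leftOption≤⌜⌝ : ∀ m {l} → l ∈ leftOptions ⌜ m ⌝ → l ≤G ⌜ m ⌝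
leftOption≤⌜⌝ m l∈ rewrite leftOption-⌜⌝ m l∈ = from (⌜⌝-≤⇔ {m ℤ.- 1ℤ} {m}) (ℤ.<⇒≤ (from -1<⇔≤ ℤ.≤-refl))

⌜⌝≤rightOption : ∀ m {r} → r ∈ rightOptions ⌜ m ⌝ → ⌜ m ⌝ ≤G r
⌜⌝≤rightOption m r∈ rewrite rightOption-⌜⌝ m r∈ = from (⌜⌝-≤⇔ {m} {m ℤ.+ 1ℤ}) (ℤ.<⇒≤ (from <+1⇔≤ ℤ.≤-refl))

pred∣suc≈⌜⌝ : ∀ n → pnode (⌜ n ℤ.- 1ℤ ⌝ ∷ []) (⌜ n ℤ.+ 1ℤ ⌝ ∷ []) ≈G ⌜ n ⌝
pred∣suc≈⌜⌝ n =
  ≤G-intro {X} {⌜ n ⌝} ((ℤ.<⇒≱ (from -1<⇔≤ ℤ.≤-refl) ∘ to (⌜⌝-≤⇔ {n} {n ℤ.- 1ℤ})) ∷ [])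
               (All.tabulate λ r∈ → rightOption⧐ {X} (here (rightOption-⌜⌝ n r∈))) ,
  ≤G-intro {⌜ n ⌝} {X} (All.tabulate λ l∈ → leftOption⧏ {X} (here (leftOption-⌜⌝ n l∈)))
                   ((ℤ.<⇒≱ (from <+1⇔≤ ℤ.≤-refl) ∘ to (⌜⌝-≤⇔ {n ℤ.+ 1ℤ} {n})) ∷ [])
  where
  X : PGame
  X = pnode (⌜ n ℤ.- 1ℤ ⌝ ∷ []) (⌜ n ℤ.+ 1ℤ ⌝ ∷ [])

mutual
  height : PGame → ℕ
  height (pnode L R) = suc (heights L ℕ.⊔ heights R)

  heights : List PGame → ℕ
  heights []       = 0
  heights (G ∷ Gs) = height G ℕ.⊔ heights Gs

∈⇒height≤heights : ∀ {G Gs} → G ∈ Gs → height G ℕ.≤ heights Gs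
∈⇒height≤heights {G} {_ ∷ Gs} (here refl) = ℕ.m≤m⊔n (height G) (heights Gs)
∈⇒height≤heights {_} {H ∷ Gs} (there G∈) = ℕ.m≤n⇒m≤o⊔n (height H) (∈⇒height≤heights G∈)

leftOption-height< : ∀ {g L R} → g ∈ L → height g ℕ.< height (pnode L R)
leftOption-height< {L = L} {R} g∈L = ℕ.s≤s (ℕ.m≤n⇒m≤n⊔o (heights R) (∈⇒height≤heights g∈L))

rightOption-height< : ∀ {h L R} → h ∈ R → height h ℕ.< height (pnode L R)
rightOption-height< {L = L} {R} h∈R = ℕ.s≤s (ℕ.m≤n⇒m≤o⊔n (heights L) (∈⇒height≤heights h∈R))

≤⌜height⌝ : ∀ G → G ≤G ⌜ + height G ⌝
≤⌜height⌝ = PGame-ind (λ G → G ≤G ⌜ + height G ⌝) λ {L} {R} L≤ _ →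
  let G = pnode L R in
  ≤G-intro {G} (All.tabulate λ {g} g∈L G≤g →
    ℕ.<⇒≱ (leftOption-height< {R = R} g∈L)
          (ℤ.drop‿+≤+ (to ⌜⌝-≤⇔ (≤G-trans ⌜ + height G ⌝ g _ G≤g (All.lookup L≤ g∈L))))) []

⌜-height⌝≤ : ∀ G → ⌜ ℤ.- + height G ⌝ ≤G G
⌜-height⌝≤ = PGame-ind (λ G → ⌜ ℤ.- + height G ⌝ ≤G G) λ {L} {R} _ ≤R →
  let G = pnode L R in
  ≤G-intro {H = G} (leftOptions-⌜-[1+]⌝ (heights L ℕ.⊔ heights R)) (All.tabulate λ {h} h∈R h≤G →
    ℕ.<⇒≱ (rightOption-height< {L = L} h∈R)
          (ℤ.drop‿+≤+ (ℤ.neg-cancel-≤ (to ⌜⌝-≤⇔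
            (≤G-trans ⌜ ℤ.- + height h ⌝ h ⌜ ℤ.- + height G ⌝ (All.lookup ≤R h∈R) h≤G)))))

IsInteger NonInteger : PGame → Set
IsInteger  G = Σ ℤ λ n → G ≈G ⌜ n ⌝
NonInteger G = ∀ n → ¬ G ≈G ⌜ n ⌝

Between : PGame → ℤ → Set
Between G k = All (λ g → ¬ ⌜ k ⌝ ≤G g) (leftOptions G) × All (λ h → ¬ h ≤G ⌜ k ⌝) (rightOptions G)

-- Walking from k towards 0 until the next integer no longer lies between the options of G
-- ends at an integer equal to G.
simplicity⁺ : ∀ G j → Between G (+ j) → IsInteger G
simplicity⁺ G zero    (GL⧏ , ⧐GR) = + zero , ≤G-intro {G} GL⧏ [] , ≤G-intro {H = G} [] ⧐GR
simplicity⁺ G (suc j) (GL⧏ , ⧐GR) with G ≤?G ⌜ + j ⌝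
... | yes G≤j = simplicity⁺ G j
      (≤G-left {G} G≤j , All.map (λ {h} h⧏ h≤j → h⧏ (≤G-trans h ⌜ + j ⌝ ⌜ + suc j ⌝ h≤j j≤1+j)) ⧐GR)
  where
  j≤1+j : ⌜ + j ⌝ ≤G ⌜ + suc j ⌝
  j≤1+j = from ⌜⌝-≤⇔ (ℤ.+≤+ (ℕ.n≤1+n j))
... | no  G≰j = + suc j , ≤G-intro {G} GL⧏ [] , ≤G-intro {H = G} (G≰j ∷ []) ⧐GR

simplicity⁻ : ∀ G j → Between G (ℤ.- + j) → IsInteger G
simplicity⁻ G zero    = simplicity⁺ G zero
simplicity⁻ G (suc j) (GL⧏ , ⧐GR) with ⌜ ℤ.- + j ⌝ ≤?G G
... | yes j≤G = simplicity⁻ G j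
      (All.map (λ {g} ⧏g j≤g → ⧏g (≤G-trans ⌜ -[1+ j ] ⌝ ⌜ ℤ.- + j ⌝ g -1-j≤-j j≤g)) GL⧏ , ≤G-right {H = G} j≤G)
  where
  -1-j≤-j : ⌜ -[1+ j ] ⌝ ≤G ⌜ ℤ.- + j ⌝
  -1-j≤-j = from ⌜⌝-≤⇔ (ℤ.neg-mono-≤ (ℤ.+≤+ (ℕ.n≤1+n j)))
... | no  j≰G = -[1+ j ] , ≤G-intro {G} GL⧏ (rightOptions-⌜-[1+]⌝ j j≰G) , ≤G-intro {H = G} (leftOptions-⌜-[1+]⌝ j) ⧐GR

simplicity : ∀ G k → Between G k → IsInteger G
simplicity G (+ j)     = simplicity⁺ G j
simplicity G -[1+ j ]  = simplicity⁻ G (suc j)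

noLeftOptions⇒integer : ∀ GR → IsInteger (pnode [] GR)
noLeftOptions⇒integer GR = simplicity⁻ G (height G) ([] , ≤G-right {⌜ ℤ.- + height G ⌝} (⌜-height⌝≤ G))
  where
  G : PGame
  G = pnode [] GR

noRightOptions⇒integer : ∀ GL → IsInteger (pnode GL [])
noRightOptions⇒integer GL = simplicity⁺ G (height G) (≤G-left {G} (≤⌜height⌝ G) , [])
  where
  G : PGame
  G = pnode GL []

nonInteger⇒leftNonEmpty : ∀ {GL GR} → NonInteger (pnode GL GR) → NonEmpty GL
nonInteger⇒leftNonEmpty {[]}    {GR} G∉ℤ = ⊥-elim (uncurry G∉ℤ (noLeftOptions⇒integer GR))
nonInteger⇒leftNonEmpty {_ ∷ _}      _   = nonempty

nonInteger⇒rightNonEmpty : ∀ {GL GR} → NonInteger (pnode GL GR) → NonEmpty GR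
nonInteger⇒rightNonEmpty {GL} {[]}    G∉ℤ = ⊥-elim (uncurry G∉ℤ (noRightOptions⇒integer GL))
nonInteger⇒rightNonEmpty {_} {_ ∷ _} _   = nonempty

∣∣≤height : ∀ {G n} → G ≈G ⌜ n ⌝ → ℤ.∣ n ∣ ℕ.≤ height G
∣∣≤height {G} {+ k}      (_ , k≤G) = ℤ.drop‿+≤+ (to ⌜⌝-≤⇔ (≤G-trans ⌜ + k ⌝ G _ k≤G (≤⌜height⌝ G)))
∣∣≤height {G} { -[1+ k ]} (G≤-k , _) =
  ℤ.drop‿+≤+ (ℤ.neg-cancel-≤ (to ⌜⌝-≤⇔ (≤G-trans ⌜ ℤ.- + height G ⌝ G ⌜ -[1+ k ] ⌝ (⌜-height⌝≤ G) G≤-k)))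

integer? : ∀ G → Dec (IsInteger G)
integer? G with ℕ.anyUpTo? (λ k → (G ≈?G ⌜ + k ⌝) ⊎-dec (G ≈?G ⌜ ℤ.- + k ⌝)) (suc (height G))
... | yes (k , _ , inj₁ G≈k)  = yes (+ k , G≈k)
... | yes (k , _ , inj₂ G≈-k) = yes (ℤ.- + k , G≈-k)
... | no  none = no λ (n , G≈n) → none (ℤ.∣ n ∣ , ℕ.s≤s (∣∣≤height G≈n) , sign n G≈n)
  where
  sign : ∀ n → G ≈G ⌜ n ⌝ → G ≈G ⌜ + ℤ.∣ n ∣ ⌝ ⊎ G ≈G ⌜ ℤ.- + ℤ.∣ n ∣ ⌝
  sign (+ k)     = inj₁
  sign -[1+ k ]  = inj₂

-- A right option of ⌜ m ⌝ below G would put m between the options of G.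
nonInteger-≤⌜⌝⇔ : ∀ {G m} → NonInteger G → G ≤G ⌜ m ⌝ ⇔ All (λ g → ¬ ⌜ m ⌝ ≤G g) (leftOptions G)
nonInteger-≤⌜⌝⇔ {G} {m} G∉ℤ = mk⇔ (≤G-left {G}) λ GL⧏m → ≤G-intro {G} GL⧏m (All.tabulate λ {r} r∈ r≤G →
  uncurry G∉ℤ (simplicity G m (GL⧏m , All.map (λ {h} h⧏r h≤m → h⧏r (≤G-trans h ⌜ m ⌝ r h≤m (⌜⌝≤rightOption m r∈)))
                                              (≤G-right {r} {G} r≤G))))

nonInteger-⌜⌝≤⇔ : ∀ {G m} → NonInteger G → ⌜ m ⌝ ≤G G ⇔ All (λ h → ¬ h ≤G ⌜ m ⌝) (rightOptions G)
nonInteger-⌜⌝≤⇔ {G} {m} G∉ℤ = mk⇔ (≤G-right {H = G}) λ m⧏GR → ≤G-intro {H = G} (All.tabulate λ {l} l∈ G≤l →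
  uncurry G∉ℤ (simplicity G m (All.map (λ {g} l⧏g m≤g → l⧏g (≤G-trans l ⌜ m ⌝ g (leftOption≤⌜⌝ m l∈) m≤g))
                                       (≤G-left {G} {l} G≤l) , m⧏GR))) m⧏GR

Pointwise-All⇔ : ∀ {A B : Set} {R : A → B → Set} {P : A → Set} {Q : B → Set} →
                 (∀ {x y} → R x y → P x ⇔ Q y) → ∀ {xs ys} → Pointwise R xs ys → All P xs ⇔ All Q ys
Pointwise-All⇔ P⇔Q []       = mk⇔ (λ _ → []) (λ _ → [])
Pointwise-All⇔ P⇔Q (r ∷ rs) =
  mk⇔ (λ { (p ∷ ps) → to (P⇔Q r) p ∷ to (Pointwise-All⇔ P⇔Q rs) ps })
      (λ { (q ∷ qs) → from (P⇔Q r) q ∷ from (Pointwise-All⇔ P⇔Q rs) qs })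

Pointwise-NonEmpty : ∀ {A B : Set} {R : A → B → Set} {xs ys} → Pointwise R xs ys → NonEmpty xs → NonEmpty ys
Pointwise-NonEmpty (_ ∷ _) nonempty = nonempty

Pointwise⇒Allʳ : ∀ {A B : Set} {Q : B → Set} {xs : List A} {ys} → Pointwise (λ _ y → Q y) xs ys → All Q ys
Pointwise⇒Allʳ []       = []
Pointwise⇒Allʳ (q ∷ qs) = q ∷ Pointwise⇒Allʳ qs

Pointwise-∈ʳ : ∀ {A B : Set} {R : A → B → Set} {xs ys y} → Pointwise R xs ys → y ∈ ys → Σ A λ x → R x y
Pointwise-∈ʳ (r ∷ _)  (here refl) = _ , r
Pointwise-∈ʳ (_ ∷ rs) (there y∈)  = Pointwise-∈ʳ rs y∈

pnode-mono : ∀ {AL AR BL BR} → Pointwise _≈G_ AL BL → Pointwise _≈G_ AR BR → pnode AL AR ≤G pnode BL BR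
pnode-mono {AL} {AR} {BL} {BR} AL≈BL AR≈BR =
  ≤G-intro {A} {B}
    (from (Pointwise-All⇔ (λ {a} {b} a≈b → ¬-cong-⇔ (≈G⇒≤G⇔ʳ {a} {b} {B} a≈b)) AL≈BL) (≤G-left {B} (≤G-refl B)))
    (to (Pointwise-All⇔ (λ {a} {b} a≈b → ¬-cong-⇔ (≈G⇒≤G⇔ˡ {a} {b} {A} a≈b)) AR≈BR) (≤G-right {H = A} (≤G-refl A)))
  where
  A B : PGame
  A = pnode AL AR
  B = pnode BL BR

pnode-cong : ∀ {AL AR BL BR} → Pointwise _≈G_ AL BL → Pointwise _≈G_ AR BR → pnode AL AR ≈G pnode BL BR
pnode-cong AL≈BL AR≈BR =
  pnode-mono AL≈BL AR≈BR , pnode-mono (Pointwise.symmetric (λ {G} {H} → ≈G-sym {G} {H}) AL≈BL)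
                                      (Pointwise.symmetric (λ {G} {H} → ≈G-sym {G} {H}) AR≈BR)

infix 4 _≤[_]_
_≤[_]_ : ℤ → Fin 2 → ℤ → Set
x ≤[ zero  ] y = x ≤ y
x ≤[ suc _ ] y = x < y

¬≤[flip]⇔ : ∀ i {x y} → (¬ x ≤[ flip i ] y) ⇔ y ≤[ i ] x
¬≤[flip]⇔ zero    = mk⇔ ℤ.≮⇒≥ ℤ.≤⇒≯
¬≤[flip]⇔ (suc _) = mk⇔ ℤ.≰⇒> ℤ.<⇒≱

≤[]-respˡ : ∀ i {z} → (λ x → x ≤[ i ] z) Respects _≥_
≤[]-respˡ zero    = ℤ.≤-trans
≤[]-respˡ (suc _) = ℤ.≤-<-trans

≤[]-respʳ : ∀ i {z} → (λ x → z ≤[ i ] x) Respects _≤_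
≤[]-respʳ zero    y≤x z≤y = ℤ.≤-trans z≤y y≤x
≤[]-respʳ (suc _) y≤x z<y = ℤ.<-≤-trans z<y y≤x

⊔⇔ : ∀ {P : ℤ → Set} → P Respects _≥_ → ∀ a b → P (a ⊔ b) ⇔ (P a × P b)
⊔⇔ {P} resp a b = mk⇔ (λ P[a⊔b] → resp (ℤ.i≤i⊔j a b) P[a⊔b] , resp (ℤ.i≤j⊔i a b) P[a⊔b]) select
  where
  select : P a × P b → P (a ⊔ b)
  select (Pa , Pb) with ℤ.⊔-sel a b
  ... | inj₁ a⊔b≡a = subst P (sym a⊔b≡a) Pa
  ... | inj₂ a⊔b≡b = subst P (sym a⊔b≡b) Pb

⊓⇔ : ∀ {P : ℤ → Set} → P Respects _≤_ → ∀ a b → P (a ⊓ b) ⇔ (P a × P b)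
⊓⇔ {P} resp a b = mk⇔ (λ P[a⊓b] → resp (ℤ.i⊓j≤i a b) P[a⊓b] , resp (ℤ.i⊓j≤j a b) P[a⊓b]) select
  where
  select : P a × P b → P (a ⊓ b)
  select (Pa , Pb) with ℤ.⊓-sel a b
  ... | inj₁ a⊓b≡a = subst P (sym a⊓b≡a) Pa
  ... | inj₂ a⊓b≡b = subst P (sym a⊓b≡b) Pb

maxRo⇔ : ∀ {P : ℤ → Set} → P Respects _≥_ → ∀ s ss → P (maxRo s ss) ⇔ All (P ∘ Ro) (s ∷ ss)
maxRo⇔ resp s []       = mk⇔ (_∷ []) All.head
maxRo⇔ resp s (t ∷ ts) =
  mk⇔ (λ { (Ps , Pts) → Ps ∷ to (maxRo⇔ resp t ts) Pts })
      (λ { (Ps ∷ Pts) → Ps , from (maxRo⇔ resp t ts) Pts })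
  ⇔-∘ ⊔⇔ resp (Ro s) (maxRo t ts)

minLo⇔ : ∀ {P : ℤ → Set} → P Respects _≤_ → ∀ s ss → P (minLo s ss) ⇔ All (P ∘ Lo) (s ∷ ss)
minLo⇔ resp s []       = mk⇔ (_∷ []) All.head
minLo⇔ resp s (t ∷ ts) =
  mk⇔ (λ { (Ps , Pts) → Ps ∷ to (minLo⇔ resp t ts) Pts })
      (λ { (Ps ∷ Pts) → Ps , from (minLo⇔ resp t ts) Pts })
  ⇔-∘ ⊓⇔ resp (Lo s) (minLo t ts)

module _ (P : Fin 2 → PGame → SGame → Set)
         (int₀ : ∀ {G n} → G ≈G ⌜ n ⌝ → P zero G (int n))
         (int₁ : ∀ {G n} → G ≈G ⌜ n ⌝ → P (suc zero) G (snode (int (n ℤ.- 1ℤ) ∷ []) (int (n ℤ.+ 1ℤ) ∷ [])))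
         (node : ∀ {i GL GR SL SR} → NonInteger (pnode GL GR) →
                 Pointwise (P (flip i)) GL SL → Pointwise (P (flip i)) GR SR → P i (pnode GL GR) (snode SL SR))
         where
  mutual
    Phi-rec : ∀ {i G S} → Phi i G S → P i G S
    Phi-rec (phi0-int G≈n)          = int₀ G≈n
    Phi-rec (phi1-int G≈n)          = int₁ G≈n
    Phi-rec (phi-node G∉ℤ GLφ GRφ)  = node G∉ℤ (Phi-rec* GLφ) (Phi-rec* GRφ)

    Phi-rec* : ∀ {i Gs Ss} → Pointwise (Phi i) Gs Ss → Pointwise (P i) Gs Ss
    Phi-rec* []       = []
    Phi-rec* (φ ∷ φs) = Phi-rec φ ∷ Phi-rec* φs

Phi-exists-integer : ∀ i {G} → IsInteger G → Σ SGame (Phi i G)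
Phi-exists-integer zero       (n , G≈n) = int n , phi0-int G≈n
Phi-exists-integer (suc zero) (n , G≈n) = _ , phi1-int {n = n} G≈n

mutual
  Phi-exists : ∀ i G → Σ SGame (Phi i G)
  Phi-exists i G@(pnode GL GR) with integer? G
  ... | yes G∈ℤ = Phi-exists-integer i G∈ℤ
  ... | no G∉ℤ with Phi-exists* (flip i) GL | Phi-exists* (flip i) GR
  ...   | SL , GLφ | SR , GRφ = snode SL SR , phi-node (curry G∉ℤ) GLφ GRφ

  Phi-exists* : ∀ i Gs → Σ (List SGame) (Pointwise (Phi i) Gs)
  Phi-exists* i [] = [] , []
  Phi-exists* i (G ∷ Gs) with Phi-exists i G | Phi-exists* i Gs
  ... | S , φ | Ss , φs = S ∷ Ss , φ ∷ φs

Phi⇒WT : ∀ {i G S} → Phi i G S → WT i S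
Phi⇒WT = Phi-rec (λ i _ S → WT i S) (λ _ → wt-int) (λ _ → wt-node nonempty nonempty at-int at-int)
  λ {_} {GL} G∉ℤ GLwt GRwt →
    wt-node (Pointwise-NonEmpty GLwt (nonInteger⇒leftNonEmpty G∉ℤ))
            (Pointwise-NonEmpty GRwt (nonInteger⇒rightNonEmpty {GL} G∉ℤ))
            (All.lookup (Pointwise⇒Allʳ GLwt)) (All.lookup (Pointwise⇒Allʳ GRwt))
  where
  at-int : ∀ {n K} → K ∈ int n ∷ [] → WT zero K
  at-int (here refl) = wt-int

ψs-Pointwise : ∀ {Gs Ss} → Pointwise (λ G S → ψ S ≈G G) Gs Ss → Pointwise _≈G_ (ψs Ss) Gs
ψs-Pointwise []       = []
ψs-Pointwise (e ∷ es) = e ∷ ψs-Pointwise es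

ψ-Phi : ∀ {i G S} → Phi i G S → ψ S ≈G G
ψ-Phi = Phi-rec (λ _ G S → ψ S ≈G G) (λ {G} {n} → ≈G-sym {G} {⌜ n ⌝})
  (λ {G} {n} G≈n → ≈G-trans {C = G} (pred∣suc≈⌜⌝ n) (≈G-sym {G} G≈n))
  λ _ GL≈ GR≈ → pnode-cong (ψs-Pointwise GL≈) (ψs-Pointwise GR≈)

OutcomesLocate : Fin 2 → PGame → SGame → Set
OutcomesLocate i G S = ∀ m → (G ≤G ⌜ m ⌝ ⇔ Lo S ≤[ i ] m) × (⌜ m ⌝ ≤G G ⇔ m ≤[ i ] Ro S)

OutcomesLocate-int : ∀ {G n} → G ≈G ⌜ n ⌝ → OutcomesLocate zero G (int n)
OutcomesLocate-int {G} {n} G≈n m =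
  ⌜⌝-≤⇔ ⇔-∘ ≈G⇒≤G⇔ˡ {G} {⌜ n ⌝} {⌜ m ⌝} G≈n , ⌜⌝-≤⇔ ⇔-∘ ≈G⇒≤G⇔ʳ {G} {⌜ n ⌝} {⌜ m ⌝} G≈n

OutcomesLocate-pred∣suc : ∀ {G n} → G ≈G ⌜ n ⌝ →
  OutcomesLocate (suc zero) G (snode (int (n ℤ.- 1ℤ) ∷ []) (int (n ℤ.+ 1ℤ) ∷ []))
OutcomesLocate-pred∣suc {G} {n} G≈n m = below , above
  where
  open ⇔-Reasoning
  below : G ≤G ⌜ m ⌝ ⇔ n ℤ.- 1ℤ < m
  below = begin
    (G ≤G ⌜ m ⌝)      ≈⟨ ≈G⇒≤G⇔ˡ {G} {⌜ n ⌝} {⌜ m ⌝} G≈n ⟩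
    (⌜ n ⌝ ≤G ⌜ m ⌝)  ≈⟨ ⌜⌝-≤⇔ ⟩
    (n ≤ m)           ≈˘⟨ -1<⇔≤ ⟩
    (n ℤ.- 1ℤ < m)    ∎
  above : ⌜ m ⌝ ≤G G ⇔ m < n ℤ.+ 1ℤ
  above = begin
    (⌜ m ⌝ ≤G G)      ≈⟨ ≈G⇒≤G⇔ʳ {G} {⌜ n ⌝} {⌜ m ⌝} G≈n ⟩
    (⌜ m ⌝ ≤G ⌜ n ⌝)  ≈⟨ ⌜⌝-≤⇔ ⟩
    (m ≤ n)           ≈˘⟨ <+1⇔≤ ⟩
    (m < n ℤ.+ 1ℤ)    ∎

OutcomesLocate-node : ∀ {i GL GR SL SR} → NonInteger (pnode GL GR) →
  Pointwise (OutcomesLocate (flip i)) GL SL → Pointwise (OutcomesLocate (flip i)) GR SR →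
  OutcomesLocate i (pnode GL GR) (snode SL SR)
OutcomesLocate-node {i} {GL} {GR} G∉ℤ GL-loc GR-loc m
  with Pointwise-NonEmpty GL-loc (nonInteger⇒leftNonEmpty G∉ℤ)
     | Pointwise-NonEmpty GR-loc (nonInteger⇒rightNonEmpty {GL} G∉ℤ)
... | nonempty {s} {ss} | nonempty {t} {ts} = below , above
  where
  open ⇔-Reasoning
  G : PGame
  G = pnode GL GR
  below : G ≤G ⌜ m ⌝ ⇔ maxRo s ss ≤[ i ] m
  below = begin
    (G ≤G ⌜ m ⌝)                        ≈⟨ nonInteger-≤⌜⌝⇔ {m = m} G∉ℤ ⟩
    All (λ g → ¬ ⌜ m ⌝ ≤G g) GL         ≈⟨ Pointwise-All⇔ (λ loc → ¬≤[flip]⇔ i ⇔-∘ ¬-cong-⇔ (proj₂ (loc m))) GL-loc ⟩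
    All (λ s → Ro s ≤[ i ] m) (s ∷ ss)  ≈˘⟨ maxRo⇔ (≤[]-respˡ i) s ss ⟩
    (maxRo s ss ≤[ i ] m)               ∎
  above : ⌜ m ⌝ ≤G G ⇔ m ≤[ i ] minLo t ts
  above = begin
    (⌜ m ⌝ ≤G G)                        ≈⟨ nonInteger-⌜⌝≤⇔ {m = m} G∉ℤ ⟩
    All (λ h → ¬ h ≤G ⌜ m ⌝) GR         ≈⟨ Pointwise-All⇔ (λ loc → ¬≤[flip]⇔ i ⇔-∘ ¬-cong-⇔ (proj₁ (loc m))) GR-loc ⟩
    All (λ t → m ≤[ i ] Lo t) (t ∷ ts)  ≈˘⟨ minLo⇔ (≤[]-respʳ i) t ts ⟩
    (m ≤[ i ] minLo t ts)               ∎

Phi⇒OutcomesLocate : ∀ {i G S} → Phi i G S → OutcomesLocate i G S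
Phi⇒OutcomesLocate = Phi-rec OutcomesLocate OutcomesLocate-int OutcomesLocate-pred∣suc OutcomesLocate-node

gapBound : Fin 2 → ℤ
gapBound zero    = 0ℤ
gapBound (suc _) = + 2

OutcomesLocate⇒≤ : ∀ {i G S a b} → OutcomesLocate i G S → a ≤[ i ] Ro S → Lo S ≤[ i ] b → a ≤ b
OutcomesLocate⇒≤ {G = G} {a = a} {b} loc a≤Ro Lo≤b =
  to ⌜⌝-≤⇔ (≤G-trans ⌜ a ⌝ G ⌜ b ⌝ (from (proj₂ (loc a)) a≤Ro) (from (proj₁ (loc b)) Lo≤b))

-1≤+1⇒-≤2 : ∀ x y → x ℤ.- 1ℤ ≤ y ℤ.+ 1ℤ → x ℤ.- y ≤ + 2
-1≤+1⇒-≤2 x y x-1≤y+1 = begin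
  x ℤ.- y                          ≡⟨ split x y ⟩
  (x ℤ.- 1ℤ) ℤ.+ (1ℤ ℤ.- y)        ≤⟨ ℤ.+-monoˡ-≤ (1ℤ ℤ.- y) x-1≤y+1 ⟩
  (y ℤ.+ 1ℤ) ℤ.+ (1ℤ ℤ.- y)        ≡⟨ cancel y ⟩
  + 2                              ∎
  where
  open ℤ.≤-Reasoning
  split : ∀ x y → x ℤ.- y ≡ (x ℤ.- 1ℤ) ℤ.+ (1ℤ ℤ.- y)
  split = solve-∀
  cancel : ∀ y → (y ℤ.+ 1ℤ) ℤ.+ (1ℤ ℤ.- y) ≡ + 2
  cancel = solve-∀

OutcomesLocate⇒gap : ∀ {i G S} → OutcomesLocate i G S → Ro S ℤ.- Lo S ≤ gapBound i
OutcomesLocate⇒gap {zero}  {G} {S} loc = ℤ.i≤j⇒i-j≤0 (OutcomesLocate⇒≤ {G = G} {S} loc ℤ.≤-refl ℤ.≤-refl)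
OutcomesLocate⇒gap {suc k} {G} {S} loc =
  -1≤+1⇒-≤2 (Ro S) (Lo S)
    (OutcomesLocate⇒≤ {suc k} {G} {S} loc (from (-1<⇔≤ {Ro S}) ℤ.≤-refl) (from (<+1⇔≤ {Lo S}) ℤ.≤-refl))

flip-injective : ∀ {i j} → flip i ≡ flip j → i ≡ j
flip-injective {zero}       {zero}       _ = refl
flip-injective {suc zero}   {suc zero}   _ = refl
flip-injective {zero}       {suc zero}   ()
flip-injective {suc zero}   {zero}       ()

WT-parity-unique : ∀ {i j K} → WT i K → WT j K → i ≡ j
WT-parity-unique wt-int wt-int = refl
WT-parity-unique (wt-node nonempty _ K-wt _) (wt-node _ _ K-wt′ _) =
  flip-injective (WT-parity-unique (K-wt (here refl)) (K-wt′ (here refl)))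

WT⇒integer-subgame : ∀ {i S} → WT i S → Σ ℤ λ n → int n ⊑ S
WT⇒integer-subgame wt-int = _ , sub-refl
WT⇒integer-subgame (wt-node nonempty _ K-wt _) with WT⇒integer-subgame (K-wt (here refl))
... | n , n⊑K = n , sub-left (here refl) n⊑K

⊑int⇒≡ : ∀ {K n} → K ⊑ int n → K ≡ int n
⊑int⇒≡ sub-refl = refl

int-Phi : ∀ n → Phi zero ⌜ n ⌝ (int n)
int-Phi n = phi0-int (≈G-refl ⌜ n ⌝)

Phi-subgame : ∀ {i G S K} → Phi i G S → K ⊑ S → Σ (Fin 2) λ j → Σ PGame λ H → Phi j H K
Phi-subgame {i} {G} φ sub-refl = i , G , φ
Phi-subgame (phi1-int _) (sub-left  (here refl) K⊑) rewrite ⊑int⇒≡ K⊑ = zero , _ , int-Phi _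
Phi-subgame (phi1-int _) (sub-right (here refl) K⊑) rewrite ⊑int⇒≡ K⊑ = zero , _ , int-Phi _
Phi-subgame (phi-node _ GLφ _) (sub-left  S∈ K⊑) = Phi-subgame (proj₂ (Pointwise-∈ʳ GLφ S∈)) K⊑
Phi-subgame (phi-node _ _ GRφ) (sub-right S∈ K⊑) = Phi-subgame (proj₂ (Pointwise-∈ʳ GRφ S∈)) K⊑

Phi-gap : ∀ {i G S} → Phi i G S → ∀ j → GapAtMost j S (gapBound j)
Phi-gap φ j K K⊑S K-wt with Phi-subgame φ K⊑S
... | _ , _ , φK with WT-parity-unique (Phi⇒WT φK) K-wt
... | refl = OutcomesLocate⇒gap {S = K} (Phi⇒OutcomesLocate φK)

Phi⇒InJ : ∀ {i G S} → Phi i G S → InJ S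
Phi⇒InJ φ with WT⇒integer-subgame (Phi⇒WT φ)
... | n , n⊑S = (Phi-gap φ zero , int n , n⊑S , wt-int , ℤ.+-inverseʳ n) , Phi-gap φ (suc zero)

mainTheorem16 : (i : Fin 2) (G : PGame) →
    Σ SGame (λ S → Phi i G S) ×
    (∀ S → Phi i G S → WT i S × InJ S × (ψ S ≈G G))
mainTheorem16 i G = Phi-exists i G , λ S φ → Phi⇒WT φ , Phi⇒InJ φ , ψ-Phi φ
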